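{- Let $T_1,T_2$ be two trees. Every minimum and minimal isometric-universal graph for $\{T_1,T_2\}$ is a tree.
   Context: All graphs are finite, undirected, without loops or multiple edges. For vertices $u,v$ of a graph $G$, $\mathrm{dist}_G(u,v)$ is the number of edges of a shortest $u$–$v$ path in $G$, and $\infty$ if no such path exists. A subgraph $H$ of $G$ is an isometric subgraph if $\mathrm{dist}_H(u,v)=\mathrm{dist}_G(u,v)$ for all vertices $u,v$ of $H$. A graph $\mathcal{U}$ is an isometric-universal graph for a family $\mathcal{F}$ of graphs if every graph of $\mathcal{F}$ is isomorphic to an isometric subgraph of $\mathcal{U}$. It is minimum if it has the smallest possible number of vertices among all isometric-universal graphs for $\mathcal{F}$, and minimal if no proper subgraph of $\mathcal{U}$ is an isometric-universal graph for $\mathcal{F}$. -}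

module Defs where

open import Data.Nat using (ℕ; zero; suc; _<_; _≤_)
open import Data.Fin using (Fin; inject₁; fromℕ) renaming (zero to fz; suc to fs)
open import Data.Bool using (Bool; true; false)
open import Data.Maybe using (Maybe; just; nothing)
open import Data.Product using (Σ; ∃; _×_; _,_)
open import Relation.Nullary using (¬_)
open import Relation.Binary.PropositionalEquality using (_≡_)
open import Function.Definitions using (Injective; Surjective)

record Graph : Set where
  field
    n     : ℕ
    adj   : Fin n → Fin n → Bool
    sym   : ∀ u v → adj u v ≡ adj v u
    irrefl : ∀ v → adj v v ≡ false
open Graph public

V : Graph → Set
V G = Fin (n G)

E : (G : Graph) → V G → V G → Set
E G u v = adj G u v ≡ true

data Walk (G : Graph) : V G → V G → ℕ → Set where
  nil  : ∀ {v} → Walk G v v 0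
  cons : ∀ {u w v k} → E G u w → Walk G w v k → Walk G u v (suc k)

-- Dist G u v d : dist_G(u,v) = d, where nothing stands for ∞.
-- dist is the least length of a u–v walk (= least length of a u–v path).
Dist : (G : Graph) → V G → V G → Maybe ℕ → Set
Dist G u v (just k) = Walk G u v k × (∀ j → j < k → ¬ Walk G u v j)
Dist G u v nothing  = ∀ k → ¬ Walk G u v k

-- H is isomorphic to an isometric subgraph of G: an injective,
-- edge-preserving vertex map (H ≅ its image subgraph) such that distances
-- in the image (i.e. in H) equal distances in G.
IsometricEmbedding : (H G : Graph) → (V H → V G) → Set
IsometricEmbedding H G f =
  Injective _≡_ _≡_ f ×
  (∀ u v → E H u v → E G (f u) (f v)) ×
  (∀ u v d → (Dist H u v d → Dist G (f u) (f v) d) ×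
             (Dist G (f u) (f v) d → Dist H u v d))

IsometricSubgraphOf : Graph → Graph → Set
IsometricSubgraphOf H G = Σ (V H → V G) (IsometricEmbedding H G)

IsoUniversal2 : Graph → Graph → Graph → Set
IsoUniversal2 T₁ T₂ U = IsometricSubgraphOf T₁ U × IsometricSubgraphOf T₂ U

SubgraphEmbedding : (H G : Graph) → (V H → V G) → Set
SubgraphEmbedding H G g =
  Injective _≡_ _≡_ g × (∀ u v → E H u v → E G (g u) (g v))

IsWhole : (H G : Graph) → (V H → V G) → Set
IsWhole H G g =
  Surjective _≡_ _≡_ g × (∀ u v → E G (g u) (g v) → E H u v)

MinimumIsoUniversal2 : Graph → Graph → Graph → Set
MinimumIsoUniversal2 T₁ T₂ U =
  IsoUniversal2 T₁ T₂ U × (∀ U′ → IsoUniversal2 T₁ T₂ U′ → n U ≤ n U′)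

MinimalIsoUniversal2 : Graph → Graph → Graph → Set
MinimalIsoUniversal2 T₁ T₂ U =
  IsoUniversal2 T₁ T₂ U ×
  (∀ H g → SubgraphEmbedding H U g → ¬ IsWhole H U g → ¬ IsoUniversal2 T₁ T₂ H)

Connected : Graph → Set
Connected G = ∀ u v → ∃ λ k → Walk G u v k

-- a cycle of length k+3: distinct vertices c 0, …, c (k+2), consecutive ones
-- adjacent, and the last adjacent to the first.
HasCycle : Graph → Set
HasCycle G = Σ ℕ λ k → Σ (Fin (suc (suc (suc k))) → V G) λ c →
  Injective _≡_ _≡_ c ×
  (∀ (i : Fin (suc (suc k))) → E G (c (inject₁ i)) (c (fs i))) ×
  E G (c (fromℕ (suc (suc k)))) (c fz)

IsTree : Graph → Set
IsTree G = (1 ≤ n G) × Connected G × ¬ HasCycle G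

{-# OPTIONS --safe #-}
module Submission where

-- Minimality forces every vertex and every edge of U into the image of T₁ or of T₂. Minimum size
-- forbids gluing two vertices x, y of U whenever both trees still embed isometrically afterwards,
-- as they do when x and y lie in different components; so U is connected. A cycle of U cannot lie
-- in one image, since isometric embeddings reflect edges, so it contains a path of T₁ between two
-- vertices σ, τ shared with T₂ whose second vertex, the parent ξ₁ of σ towards τ in T₁, is not
-- shared. Gluing ξ₁ to the parent ξ₂ of σ towards τ in T₂ keeps the distances of both trees,
-- because from every vertex of T₁ the vertex ξ₁ is no further than ξ₂, and symmetrically.

open import Defs renaming (sym to adj-sym; irrefl to adj-irrefl)
open import Data.Nat using (ℕ; zero; suc; _+_; _∸_; _<_; _≤_; z≤n; s≤s; _<?_; _≤?_)
open import Data.Nat.Properties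
open import Data.Nat.Induction using (<-rec)
open import Data.Nat.GeneralisedArithmetic using (iterate)
open import Data.Fin using (Fin; toℕ; fromℕ; fromℕ<; inject₁; punchIn; punchOut)
  renaming (zero to fz; suc to fs)
import Data.Fin.Properties as Fin
open import Data.Bool using (true)
import Data.Bool.Properties as Bool
open import Data.Product using (Σ; ∃; ∃-syntax; _×_; _,_; proj₁; proj₂)
open import Data.Maybe using (just; nothing)
open import Data.Sum using (_⊎_; inj₁; inj₂)
import Data.Sum as Sum
open import Data.Empty using (⊥; ⊥-elim)
open import Relation.Nullary using (¬_; Dec; yes; no)
open import Relation.Nullary.Decidable
  using (_×-dec_; _⊎-dec_; ¬?; decidable-stable; does; dec-true; dec-false; does-⇔)
open import Relation.Unary using (Decidable)
open import Relation.Binary using (tri<; tri≈; tri>)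
open import Relation.Binary.PropositionalEquality
  using (_≡_; _≢_; refl; sym; trans; cong; cong₂; subst; subst₂)
open import Function.Base using (_∘_; id)
open import Function.Bundles using (mk⇔)
open import Function.Definitions using (Injective)

least-below : ∀ {P : ℕ → Set} → Decidable P →
              ∀ k → P k → ∃[ j ] j ≤ k × P j × (∀ i → i < j → ¬ P i)
least-below {P} P? = <-rec _ search
  where
  search : ∀ k → (∀ {i} → i < k → P i → ∃[ j ] j ≤ i × P j × (∀ i → i < j → ¬ P i)) →
           P k → ∃[ j ] j ≤ k × P j × (∀ i → i < j → ¬ P i)
  search k rec pk with anyUpTo? P? k
  ... | yes (i , i<k , pi) = let j , j≤i , least = rec i<k pi in
                             j , ≤-trans j≤i (<⇒≤ i<k) , least
  ... | no none = k , ≤-refl , pk , λ i i<k pi → none (i , i<k , pi)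

module _ {P : ℕ → Set} (P? : Decidable P) where

  none-fails : ∀ {m} → ¬ (∃[ i ] i < suc m × ¬ P i) → ∀ i → i ≤ m → P i
  none-fails none i i≤m = decidable-stable (P? i) (λ ¬pi → none (i , s≤s i≤m , ¬pi))

  first-failure : ∀ {r} → P 0 → ¬ P r → ∃[ s ] suc s ≤ r × P s × ¬ P (suc s)
  first-failure {r} p0 ¬pr with least-below (¬? ∘ P?) r ¬pr
  ... | zero , _ , ¬p0 , _ = ⊥-elim (¬p0 p0)
  ... | suc s , 1+s≤r , ¬p , earlier = s , 1+s≤r , decidable-stable (P? s) (earlier s ≤-refl) , ¬p

  first-after : ∀ {a b} → a < b → P b →
                ∃[ j ] a < j × j ≤ b × P j × (∀ t → a < t → t < j → ¬ P t)
  first-after {a} {b} a<b pb with least-below (λ j → a <? j ×-dec P? j) b (a<b , pb)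
  ... | j , j≤b , (a<j , pj) , earlier =
    j , a<j , j≤b , pj , λ t a<t t<j pt → earlier t t<j (a<t , pt)

module _ (G : Graph) where

  E-sym : ∀ {u v} → E G u v → E G v u
  E-sym {u} {v} e = trans (adj-sym G v u) e

  E-irrefl : ∀ {u} → ¬ E G u u
  E-irrefl {u} e with trans (sym e) (adj-irrefl G u)
  ... | ()

  E⇒≢ : ∀ {u v} → E G u v → u ≢ v
  E⇒≢ e refl = E-irrefl e

  E? : ∀ u v → Dec (E G u v)
  E? u v = adj G u v Bool.≟ true

  walk-0⇒≡ : ∀ {u v} → Walk G u v 0 → u ≡ v
  walk-0⇒≡ nil = refl

  ≡⇒walk-0 : ∀ {u v} → u ≡ v → Walk G u v 0
  ≡⇒walk-0 refl = nil

  Walk? : ∀ k u v → Dec (Walk G u v k)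
  Walk? zero u v with u Fin.≟ v
  ... | yes refl = yes nil
  ... | no u≢v = no λ w → u≢v (walk-0⇒≡ w)
  Walk? (suc k) u v with Fin.any? (λ w → E? u w ×-dec Walk? k w v)
  ... | yes (w , e , p) = yes (cons e p)
  ... | no ¬step = no λ { (cons e p) → ¬step (_ , e , p) }

  Reachable : V G → V G → Set
  Reachable u v = ∃ (Walk G u v)

  Walk≤ : V G → V G → ℕ → Set
  Walk≤ u v k = ∃[ j ] j ≤ k × Walk G u v j

module _ {G : Graph} where

  [_] : ∀ {u v} → E G u v → Walk G u v 1
  [ e ] = cons e nil

  infixr 5 _++_
  _++_ : ∀ {u w v j k} → Walk G u w j → Walk G w v k → Walk G u v (j + k)
  nil ++ q = q
  cons e p ++ q = cons e (p ++ q)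

  _∷ʳ_ : ∀ {u w v k} → Walk G u w k → E G w v → Walk G u v (suc k)
  nil ∷ʳ e = [ e ]
  cons e p ∷ʳ e′ = cons e (p ∷ʳ e′)

  reverse : ∀ {u v k} → Walk G u v k → Walk G v u k
  reverse nil = nil
  reverse (cons e p) = reverse p ∷ʳ E-sym G e

  shortest : ∀ {u v k} → Walk G u v k → ∃[ j ] j ≤ k × Dist G u v (just j)
  shortest {u} {v} {k} = least-below (λ i → Walk? G i u v) k

  vertex : ∀ {u v k} → Walk G u v k → ℕ → V G
  vertex {u} w zero = u
  vertex {u} nil (suc i) = u
  vertex (cons e w) (suc i) = vertex w i

  prefix : ∀ {u v k} (w : Walk G u v k) i → i ≤ k → Walk G u (vertex w i) i
  prefix w zero _ = nil
  prefix (cons e w) (suc i) (s≤s i≤k) = cons e (prefix w i i≤k)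

  suffix : ∀ {u v k} (w : Walk G u v k) i → i ≤ k → Walk G (vertex w i) v (k ∸ i)
  suffix w zero _ = w
  suffix (cons e w) (suc i) (s≤s i≤k) = suffix w i i≤k

  shorten : ∀ {u v k} → Walk G u v k → n G ≤ k → ∃[ j ] j < k × Walk G u v j
  shorten {u} {v} {k} w n≤k with Fin.pigeonhole (s≤s n≤k) (λ i → vertex w (toℕ i))
  ... | i , j , i<j , same = toℕ i + (k ∸ toℕ j) , shorter , prefix w (toℕ i) i≤k ++ rest
    where
    j≤k : toℕ j ≤ k
    j≤k = ≤-pred (Fin.toℕ<n j)
    i≤k : toℕ i ≤ k
    i≤k = ≤-trans (<⇒≤ i<j) j≤k
    shorter : toℕ i + (k ∸ toℕ j) < k
    shorter = subst (toℕ i + (k ∸ toℕ j) <_) (m+[n∸m]≡n j≤k) (+-monoˡ-< (k ∸ toℕ j) i<j)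
    rest : Walk G (vertex w (toℕ i)) v (k ∸ toℕ j)
    rest = subst (λ x → Walk G x v (k ∸ toℕ j)) (sym same) (suffix w (toℕ j) j≤k)

  shorten-below-order : ∀ {u v k} → Walk G u v k → ∃[ j ] j < n G × Walk G u v j
  shorten-below-order {u} {v} {k} = <-rec (λ k → Walk G u v k → ∃[ j ] j < n G × Walk G u v j) go k
    where
    go : ∀ k → (∀ {i} → i < k → Walk G u v i → ∃[ j ] j < n G × Walk G u v j) →
         Walk G u v k → ∃[ j ] j < n G × Walk G u v j
    go k rec w with k <? n G
    ... | yes k<n = k , k<n , w
    ... | no k≮n = let j , j<k , w′ = shorten w (≮⇒≥ k≮n) in rec j<k w′

  Reachable-trans : ∀ {u v w} → Reachable G u v → Reachable G v w → Reachable G u w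
  Reachable-trans (_ , p) (_ , q) = _ , p ++ q

  Reachable-sym : ∀ {u v} → Reachable G u v → Reachable G v u
  Reachable-sym (_ , p) = _ , reverse p

Reachable? : (G : Graph) → ∀ u v → Dec (Reachable G u v)
Reachable? G u v with anyUpTo? (λ k → Walk? G k u v) (n G)
... | yes (k , _ , w) = yes (k , w)
... | no none = no λ (_ , w) → none (shorten-below-order w)

module Distance (G : Graph) (connected : Connected G) where

  private
    geodesic : ∀ u v → ∃[ j ] j ≤ proj₁ (connected u v) × Dist G u v (just j)
    geodesic u v = shortest (proj₂ (connected u v))

  dist : V G → V G → ℕ
  dist u v = proj₁ (geodesic u v)

  dist-walk : ∀ u v → Walk G u v (dist u v)
  dist-walk u v = proj₁ (proj₂ (proj₂ (geodesic u v)))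

  dist-minimal : ∀ {u v k} → Walk G u v k → dist u v ≤ k
  dist-minimal {u} {v} {k} w with k <? dist u v
  ... | yes k<d = ⊥-elim (proj₂ (proj₂ (proj₂ (geodesic u v))) k k<d w)
  ... | no k≮d = ≮⇒≥ k≮d

  dist-sym : ∀ u v → dist u v ≡ dist v u
  dist-sym u v = ≤-antisym (dist-minimal (reverse (dist-walk v u)))
                           (dist-minimal (reverse (dist-walk u v)))

  dist-triangle : ∀ u w v → dist u v ≤ dist u w + dist w v
  dist-triangle u w v = dist-minimal (dist-walk u w ++ dist-walk w v)

  dist≡0⇒≡ : ∀ {u v} → dist u v ≡ 0 → u ≡ v
  dist≡0⇒≡ {u} {v} d≡0 = walk-0⇒≡ G (subst (Walk G u v) d≡0 (dist-walk u v))

  dist-refl : ∀ u → dist u u ≡ 0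
  dist-refl u = n≤0⇒n≡0 (dist-minimal {u} nil)

  dist-edge : ∀ {u v} → E G u v → dist u v ≤ 1
  dist-edge e = dist-minimal [ e ]

Image : ∀ {A B : Set} → (A → B) → B → Set
Image f v = ∃[ a ] f a ≡ v

Image? : ∀ {k l} (f : Fin k → Fin l) → Decidable (Image f)
Image? f v = Fin.any? (λ a → f a Fin.≟ v)

IsHomomorphism : (H G : Graph) → (V H → V G) → Set
IsHomomorphism H G f = ∀ u v → E H u v → E G (f u) (f v)

map-walk : ∀ {H G f} → IsHomomorphism H G f → ∀ {a b k} → Walk H a b k → Walk G (f a) (f b) k
map-walk hom nil = nil
map-walk hom (cons e p) = cons (hom _ _ e) (map-walk hom p)

image-reachable : ∀ {T G : Graph} {f : V T → V G} → IsHomomorphism T G f → Connected T →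
                  ∀ a a′ → Reachable G (f a) (f a′)
image-reachable hom connected a a′ = _ , map-walk hom (proj₂ (connected a a′))

PullsBackWalks : (H G : Graph) → (V H → V G) → Set
PullsBackWalks H G f = ∀ a b k → Walk G (f a) (f b) k → Walk≤ H a b k

module _ {H G : Graph} {f : V H → V G} where

  isometric⇒pulls-back-walks : IsometricEmbedding H G f → PullsBackWalks H G f
  isometric⇒pulls-back-walks (_ , _ , same-dist) a b k w with shortest w
  ... | j , j≤k , geodesic = j , j≤k , proj₁ (proj₂ (same-dist a b (just j)) geodesic)

  pulls-back-walks⇒isometric : Injective _≡_ _≡_ f → IsHomomorphism H G f → PullsBackWalks H G f →
                               IsometricEmbedding H G f
  pulls-back-walks⇒isometric injective hom back =
    injective , hom , λ a b d → forward a b d , backward a b d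
    where
    forward : ∀ a b d → Dist H a b d → Dist G (f a) (f b) d
    forward a b (just k) (w , minimal) = map-walk hom w , λ i i<k wG →
      let j , j≤i , wH = back a b i wG in minimal j (≤-<-trans j≤i i<k) wH
    forward a b nothing none k wG = let j , _ , wH = back a b k wG in none j wH
    backward : ∀ a b d → Dist G (f a) (f b) d → Dist H a b d
    backward a b (just k) (w , minimal) with back a b k w
    ... | j , j≤k , wH with m≤n⇒m<n∨m≡n j≤k
    ...   | inj₁ j<k = ⊥-elim (minimal j j<k (map-walk hom wH))
    ...   | inj₂ refl = wH , λ i i<k wH′ → minimal i i<k (map-walk hom wH′)
    backward a b nothing none k wH = none k (map-walk hom wH)

  isometric-reflects-edges : IsometricEmbedding H G f → ∀ a b → E G (f a) (f b) → E H a b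
  isometric-reflects-edges iso a b e with isometric⇒pulls-back-walks iso a b 1 [ e ]
  ... | zero , _ , w with walk-0⇒≡ H w
  ...   | refl = ⊥-elim (E-irrefl G e)
  isometric-reflects-edges iso a b e | suc zero , _ , cons e′ nil = e′
  isometric-reflects-edges iso a b e | suc (suc _) , s≤s () , _

isometric-factor : ∀ {T H U : Graph} {f : V T → V U} (g : V H → V U) (h : V T → V H) →
                   IsometricEmbedding T U f → IsHomomorphism H U g → IsHomomorphism T H h →
                   (∀ a → g (h a) ≡ f a) → IsometricEmbedding T H h
isometric-factor {T} {H} {U} {f} g h iso g-hom h-hom gh≡f =
  pulls-back-walks⇒isometric h-injective h-hom back
  where
  h-injective : Injective _≡_ _≡_ h
  h-injective {a} {b} ha≡hb = proj₁ iso (trans (sym (gh≡f a)) (trans (cong g ha≡hb) (gh≡f b)))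
  back : PullsBackWalks T H h
  back a b k w = isometric⇒pulls-back-walks iso a b k
    (subst₂ (λ x y → Walk U x y k) (gh≡f a) (gh≡f b) (map-walk g-hom w))

shared-dist : ∀ {U X Y : Graph} (X-connected : Connected X) (Y-connected : Connected Y)
              {f : V X → V U} {g : V Y → V U} → IsometricEmbedding X U f → IsometricEmbedding Y U g →
              ∀ {a b a′ b′} → f a ≡ g a′ → f b ≡ g b′ →
              Distance.dist X X-connected a b ≡ Distance.dist Y Y-connected a′ b′
shared-dist {U} X-connected Y-connected f-iso g-iso fa≡ga′ fb≡gb′ =
  ≤-antisym (dist-≤ X-connected Y-connected f-iso (proj₁ (proj₂ g-iso)) fa≡ga′ fb≡gb′)
            (dist-≤ Y-connected X-connected g-iso (proj₁ (proj₂ f-iso)) (sym fa≡ga′) (sym fb≡gb′))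
  where
  dist-≤ : ∀ {X Y : Graph} (X-connected : Connected X) (Y-connected : Connected Y)
           {f : V X → V U} {g : V Y → V U} → IsometricEmbedding X U f → IsHomomorphism Y U g →
           ∀ {a b a′ b′} → f a ≡ g a′ → f b ≡ g b′ →
           Distance.dist X X-connected a b ≤ Distance.dist Y Y-connected a′ b′
  dist-≤ {X} {Y} X-connected Y-connected {f} {g} f-iso g-hom {a} {b} {a′} {b′} fa≡ga′ fb≡gb′
    with isometric⇒pulls-back-walks f-iso a b _ walk
    where
    walk : Walk U (f a) (f b) (Distance.dist Y Y-connected a′ b′)
    walk = subst₂ (λ x y → Walk U x y _) (sym fa≡ga′) (sym fb≡gb′)
             (map-walk g-hom (Distance.dist-walk Y Y-connected a′ b′))
  ... | j , j≤ , w = ≤-trans (Distance.dist-minimal X X-connected w) j≤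

record IsPath (G : Graph) (q : ℕ → V G) (m : ℕ) : Set where
  constructor is-path
  field
    step : ∀ i → i < m → E G (q i) (q (suc i))
    distinct : ∀ i j → i ≤ m → j ≤ m → q i ≡ q j → i ≡ j

infixr 5 _◃_
_◃_ : ∀ {A : Set} → A → (ℕ → A) → ℕ → A
(p ◃ q) zero = p
(p ◃ q) (suc i) = q i

module _ {G : Graph} where

  path-prefix : ∀ {q m i} → i ≤ m → IsPath G q m → IsPath G q i
  path-prefix i≤m (is-path step distinct) =
    is-path (λ j j<i → step j (<-≤-trans j<i i≤m))
            (λ a b a≤i b≤i → distinct a b (≤-trans a≤i i≤m) (≤-trans b≤i i≤m))

  path-tail : ∀ {q m} → IsPath G q (suc m) → IsPath G (λ i → q (suc i)) m
  path-tail (is-path step distinct) =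
    is-path (λ i i<m → step (suc i) (s≤s i<m))
            (λ i j i≤m j≤m same → suc-injective (distinct _ _ (s≤s i≤m) (s≤s j≤m) same))

  path-prepend : ∀ {p q m} → E G p (q 0) → (∀ i → i ≤ m → q i ≢ p) → IsPath G q m →
                 IsPath G (p ◃ q) (suc m)
  path-prepend {p} {q} {m} e fresh (is-path step distinct) = is-path step′ distinct′
    where
    step′ : ∀ i → i < suc m → E G ((p ◃ q) i) ((p ◃ q) (suc i))
    step′ zero _ = e
    step′ (suc i) (s≤s i<m) = step i i<m
    distinct′ : ∀ i j → i ≤ suc m → j ≤ suc m → (p ◃ q) i ≡ (p ◃ q) j → i ≡ j
    distinct′ zero zero _ _ _ = refl
    distinct′ zero (suc j) _ (s≤s j≤m) same = ⊥-elim (fresh j j≤m (sym same))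
    distinct′ (suc i) zero (s≤s i≤m) _ same = ⊥-elim (fresh i i≤m same)
    distinct′ (suc i) (suc j) (s≤s i≤m) (s≤s j≤m) same = cong suc (distinct i j i≤m j≤m same)

  path-reverse : ∀ {q m} → IsPath G q m → IsPath G (λ i → q (m ∸ i)) m
  path-reverse {q} {m} (is-path step distinct) = is-path step′ distinct′
    where
    step′ : ∀ i → i < m → E G (q (m ∸ i)) (q (m ∸ suc i))
    step′ i i<m = subst (λ x → E G (q x) (q (m ∸ suc i))) (sym (+-∸-assoc 1 i<m))
                     (E-sym G (step (m ∸ suc i) (∸-monoʳ-< (s≤s z≤n) i<m)))
    distinct′ : ∀ i j → i ≤ m → j ≤ m → q (m ∸ i) ≡ q (m ∸ j) → i ≡ j
    distinct′ i j i≤m j≤m same = ∸-cancelˡ-≡ i≤m j≤m (distinct _ _ (m∸n≤m m i) (m∸n≤m m j) same)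

  edge-path : ∀ {u v} → E G u v → IsPath G (u ◃ λ _ → v) 1
  edge-path {u} {v} e = path-prepend e fresh (is-path (λ _ ()) single)
    where
    fresh : ∀ i → i ≤ 0 → v ≢ u
    fresh _ _ v≡u = E⇒≢ G e (sym v≡u)
    single : ∀ i j → i ≤ 0 → j ≤ 0 → v ≡ v → i ≡ j
    single zero zero _ _ _ = refl

  closed-path⇒cycle : ∀ {q k} → IsPath G q (suc (suc k)) → E G (q (suc (suc k))) (q 0) → HasCycle G
  closed-path⇒cycle {q} {k} (is-path step distinct) closing =
    k , q ∘ toℕ , injective , step′ , closing′
    where
    injective : Injective _≡_ _≡_ (q ∘ toℕ)
    injective {i} {j} = Fin.toℕ-injective ∘ distinct _ _ (≤-pred (Fin.toℕ<n i)) (≤-pred (Fin.toℕ<n j))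
    step′ : ∀ (i : Fin (suc (suc k))) → E G (q (toℕ (inject₁ i))) (q (suc (toℕ i)))
    step′ i rewrite Fin.toℕ-inject₁ i = step (toℕ i) (Fin.toℕ<n i)
    closing′ : E G (q (toℕ (fromℕ (suc (suc k))))) (q 0)
    closing′ rewrite Fin.toℕ-fromℕ (suc (suc k)) = closing

  cycle⇒closed-path : HasCycle G →
                      ∃[ k ] Σ (ℕ → V G) λ q → IsPath G q (suc (suc k)) × E G (q (suc (suc k))) (q 0)
  cycle⇒closed-path (k , c , injective , step , closing) = k , q , is-path step′ distinct′ , closing′
    where
    q : ℕ → V G
    q i with i <? suc (suc (suc k))
    ... | yes i<3+k = c (fromℕ< i<3+k)
    ... | no _ = c fz
    q-at : ∀ x i → toℕ x ≡ i → q i ≡ c x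
    q-at x i refl with toℕ x <? suc (suc (suc k))
    ... | yes i<3+k = cong c (Fin.fromℕ<-toℕ x i<3+k)
    ... | no i≮3+k = ⊥-elim (i≮3+k (Fin.toℕ<n x))
    step′ : ∀ i → i < suc (suc k) → E G (q i) (q (suc i))
    step′ i i<2+k = subst₂ (E G) (sym (q-at (inject₁ x) i (trans (Fin.toℕ-inject₁ x) toℕx≡i)))
                               (sym (q-at (fs x) (suc i) (cong suc toℕx≡i))) (step x)
      where
      x = fromℕ< i<2+k
      toℕx≡i = Fin.toℕ-fromℕ< i<2+k
    distinct′ : ∀ i j → i ≤ suc (suc k) → j ≤ suc (suc k) → q i ≡ q j → i ≡ j
    distinct′ i j i≤ j≤ same = Fin.fromℕ<-injective i j (s≤s i≤) (s≤s j≤)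
      (injective (trans (sym (q-at _ i (Fin.toℕ-fromℕ< (s≤s i≤))))
                        (trans same (q-at _ j (Fin.toℕ-fromℕ< (s≤s j≤))))))
    closing′ : E G (q (suc (suc k))) (q 0)
    closing′ = subst₂ (E G) (sym (q-at (fromℕ (suc (suc k))) _ (Fin.toℕ-fromℕ _))) (sym (q-at fz 0 refl))
                 closing

bounded-choice : ∀ {A : Set} {P : ℕ → A → Set} {m} → (∀ i → i ≤ m → ∃ (P i)) →
                 Σ (ℕ → A) λ p → ∀ i → i ≤ m → P i (p i)
bounded-choice {A} {P} {m} choose = p , p-spec
  where
  p : ℕ → A
  p i with i ≤? m
  ... | yes i≤m = proj₁ (choose i i≤m)
  ... | no _ = proj₁ (choose 0 z≤n)
  p-spec : ∀ i → i ≤ m → P i (p i)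
  p-spec i i≤m with i ≤? m
  ... | yes i≤m′ = proj₂ (choose i i≤m′)
  ... | no i≰m = ⊥-elim (i≰m i≤m)

lift-path : ∀ {T G : Graph} {f : V T → V G} → IsometricEmbedding T G f →
            ∀ {q p m} → (∀ i → i ≤ m → f (p i) ≡ q i) → IsPath G q m → IsPath T p m
lift-path {T} {G} {f} iso {q} {p} lifts (is-path step distinct) = is-path step′ distinct′
  where
  step′ : ∀ i → i < _ → E T (p i) (p (suc i))
  step′ i i<m = isometric-reflects-edges iso (p i) (p (suc i))
                  (subst₂ (E G) (sym (lifts i (<⇒≤ i<m))) (sym (lifts (suc i) i<m)) (step i i<m))
  distinct′ : ∀ i j → i ≤ _ → j ≤ _ → p i ≡ p j → i ≡ j
  distinct′ i j i≤m j≤m same =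
    distinct i j i≤m j≤m (trans (sym (lifts i i≤m)) (trans (cong f same) (lifts j j≤m)))

lift-cycle : ∀ {T G : Graph} {f : V T → V G} → IsometricEmbedding T G f →
             ∀ {q k} → IsPath G q (suc (suc k)) → E G (q (suc (suc k))) (q 0) →
             (∀ i → i ≤ suc (suc k) → Image f (q i)) → HasCycle T
lift-cycle {T} {G} {f} iso {q} {k} path closing in-image with bounded-choice in-image
... | p , lifts = closed-path⇒cycle (lift-path iso lifts path) (isometric-reflects-edges iso _ _
                    (subst₂ (E G) (sym (lifts _ ≤-refl)) (sym (lifts 0 z≤n)) closing))

module ClosedWalk {G : Graph} {q : ℕ → V G} {m : ℕ} (path : IsPath G q m) (closing : E G (q m) (q 0))
  where
  open IsPath path

  at : ℕ → V G
  at i with i ≤? m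
  ... | yes _ = q i
  ... | no _ = q 0

  at-≤ : ∀ {i} → i ≤ m → at i ≡ q i
  at-≤ {i} i≤m with i ≤? m
  ... | yes _ = refl
  ... | no i≰m = ⊥-elim (i≰m i≤m)

  at-last : at (suc m) ≡ q 0
  at-last with suc m ≤? m
  ... | yes 1+m≤m = ⊥-elim (1+n≰n 1+m≤m)
  ... | no _ = refl

  at-step : ∀ i → i ≤ m → E G (at i) (at (suc i))
  at-step i i≤m with m≤n⇒m<n∨m≡n i≤m
  ... | inj₁ i<m = subst₂ (E G) (sym (at-≤ i≤m)) (sym (at-≤ i<m)) (step i i<m)
  ... | inj₂ refl = subst₂ (E G) (sym (at-≤ i≤m)) (sym at-last) closing

  at-distinct : ∀ {i j} → i < j → j ≤ suc m → at i ≡ at j → i ≡ 0 × j ≡ suc m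
  at-distinct {i} {j} i<j j≤1+m same with m≤n⇒m<n∨m≡n j≤1+m
  ... | inj₁ (s≤s j≤m) =
    ⊥-elim (<-irrefl (distinct i j i≤m j≤m (trans (sym (at-≤ i≤m)) (trans same (at-≤ j≤m)))) i<j)
    where i≤m = ≤-trans (<⇒≤ i<j) j≤m
  ... | inj₂ refl = distinct i 0 i≤m z≤n (trans (sym (at-≤ i≤m)) (trans same at-last)) , refl
    where i≤m = ≤-pred i<j

CoversVertices : ∀ {X : Set} → (X → Set) → (X → Set) → Set
CoversVertices A B = ∀ v → A v ⊎ B v

CoversEdges : (G : Graph) → (V G → Set) → (V G → Set) → Set
CoversEdges G A B = ∀ u v → E G u v → (A u × A v) ⊎ (B u × B v)

CoversVertices-swap : ∀ {X : Set} {A B : X → Set} → CoversVertices A B → CoversVertices B A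
CoversVertices-swap cover = Sum.swap ∘ cover

CoversEdges-swap : ∀ {G : Graph} {A B : V G → Set} → CoversEdges G A B → CoversEdges G B A
CoversEdges-swap cover u v e = Sum.swap (cover u v e)

Excursion : (G : Graph) → (V G → Set) → (V G → Set) → (ℕ → V G) → ℕ → Set
Excursion G A B p ℓ =
  IsPath G p (suc ℓ) × (∀ t → t ≤ suc ℓ → A (p t)) × B (p 0) × ¬ B (p 1) × B (p (suc ℓ))

-- Walk round the cycle from its B-vertex q 0 to the first vertex outside B and on to the next
-- vertex in B; the vertex outside A keeps this stretch from wrapping round the whole cycle.
module CycleExcursion {G : Graph} {A B : V G → Set} (B? : Decidable B)
         (vertex-cover : CoversVertices A B) (edge-cover : CoversEdges G A B)
         {q : ℕ → V G} {m : ℕ} (path : IsPath G q m) (closing : E G (q m) (q 0)) (q0∈B : B (q 0)) where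
  open ClosedWalk path closing

  private
    outside-B⇒A : ∀ {v} → ¬ B v → A v
    outside-B⇒A {v} v∉B with vertex-cover v
    ... | inj₁ v∈A = v∈A
    ... | inj₂ v∈B = ⊥-elim (v∉B v∈B)

    A-edge-to : ∀ {u v} → E G u v → ¬ B v → A u
    A-edge-to {u} {v} e v∉B with edge-cover u v e
    ... | inj₁ (u∈A , _) = u∈A
    ... | inj₂ (_ , v∈B) = ⊥-elim (v∉B v∈B)

    A-edge-from : ∀ {u v} → E G u v → ¬ B u → A v
    A-edge-from {u} {v} e u∉B with edge-cover u v e
    ... | inj₁ (_ , v∈A) = v∈A
    ... | inj₂ (u∈B , _) = ⊥-elim (u∉B u∈B)

  module _ (r : ℕ) (r≤m : r ≤ m) (r∉A : ¬ A (q r))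
           (s : ℕ) (s<m : s < m) (s∈B : B (at s)) (1+s∉B : ¬ B (at (suc s)))
           (j : ℕ) (1+s<j : suc s < j) (j≤1+m : j ≤ suc m) (j∈B : B (at j))
           (inside : ∀ t → suc s < t → t < j → ¬ B (at t)) where

    private
      d = j ∸ suc (suc s)
      ℓ = suc d

      end : suc ℓ + s ≡ j
      end = trans (sym (trans (+-suc d (suc s)) (cong suc (+-suc d s)))) (m∸n+n≡m 1+s<j)

      stretch : ℕ → V G
      stretch t = at (t + s)

      ≤m : ∀ {t} → t < suc ℓ → t + s ≤ m
      ≤m t<1+ℓ = ≤-pred (≤-trans (subst (_ <_) end (+-monoˡ-< s t<1+ℓ)) j≤1+m)

      interior∉B : ∀ u → suc s ≤ u → u < j → ¬ B (at u)
      interior∉B u 1+s≤u u<j with m≤n⇒m<n∨m≡n 1+s≤u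
      ... | inj₁ 1+s<u = inside u 1+s<u u<j
      ... | inj₂ refl = 1+s∉B

      s∈A : A (at s)
      s∈A = A-edge-to (at-step s (<⇒≤ s<m)) 1+s∉B

      no-wraparound : s ≡ 0 → j ≡ suc m → ⊥
      no-wraparound s≡0 j≡1+m = outside r r≤m r∉A
        where
        outside : ∀ r → r ≤ m → ¬ A (q r) → ⊥
        outside zero _ 0∉A = 0∉A (subst A (trans (cong at s≡0) (at-≤ z≤n)) s∈A)
        outside (suc r₀) 1+r₀≤m r∉A with vertex-cover (q (suc r₀))
        ... | inj₁ r∈A = r∉A r∈A
        ... | inj₂ r∈B = interior∉B (suc r₀) (s≤s (subst (_≤ r₀) (sym s≡0) z≤n))
                           (subst (suc r₀ <_) (sym j≡1+m) (s≤s 1+r₀≤m))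
                           (subst B (sym (at-≤ 1+r₀≤m)) r∈B)

      step′ : ∀ t → t < suc ℓ → E G (stretch t) (stretch (suc t))
      step′ t t<1+ℓ = at-step (t + s) (≤m t<1+ℓ)

      ≤j : ∀ {t} → t ≤ suc ℓ → t + s ≤ j
      ≤j t≤1+ℓ = subst (_ ≤_) end (+-monoˡ-≤ s t≤1+ℓ)

      wraps : ∀ {t t′} → t < t′ → t′ ≤ suc ℓ → stretch t ≡ stretch t′ → ⊥
      wraps {t} {t′} t<t′ t′≤1+ℓ same
        with at-distinct (+-monoˡ-< s t<t′) (≤-trans (≤j t′≤1+ℓ) j≤1+m) same
      ... | t+s≡0 , t′+s≡1+m =
        no-wraparound (m+n≡0⇒n≡0 t t+s≡0)
                      (≤-antisym j≤1+m (subst (_≤ j) t′+s≡1+m (≤j t′≤1+ℓ)))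

      distinct′ : ∀ t t′ → t ≤ suc ℓ → t′ ≤ suc ℓ → stretch t ≡ stretch t′ → t ≡ t′
      distinct′ t t′ t≤1+ℓ t′≤1+ℓ same with <-cmp t t′
      ... | tri< t<t′ _ _ = ⊥-elim (wraps t<t′ t′≤1+ℓ same)
      ... | tri≈ _ t≡t′ _ = t≡t′
      ... | tri> _ _ t′<t = ⊥-elim (wraps t′<t t≤1+ℓ (sym same))

      in-A : ∀ t → t ≤ suc ℓ → A (stretch t)
      in-A zero _ = s∈A
      in-A (suc t) 1+t≤1+ℓ with m≤n⇒m<n∨m≡n 1+t≤1+ℓ
      ... | inj₁ 1+t<1+ℓ = outside-B⇒A (interior∉B (suc t + s) (s≤s (m≤n+m s t))
                                         (<-≤-trans (+-monoˡ-< s 1+t<1+ℓ) (≤j ≤-refl)))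
      ... | inj₂ refl =
        A-edge-from (step′ ℓ ≤-refl) (interior∉B (ℓ + s) (s≤s (m≤n+m s d)) (≤j ≤-refl))

    excursion : Excursion G A B stretch ℓ
    excursion = is-path step′ distinct′ , in-A , s∈B , 1+s∉B , subst B (cong at (sym end)) j∈B

  cycle-excursion : (∃[ r ] r ≤ m × ¬ A (q r)) → (∃[ r ] r ≤ m × ¬ B (q r)) →
                    ∃[ p ] ∃[ ℓ ] Excursion G A B p ℓ
  cycle-excursion (r , r≤m , r∉A) (r′ , r′≤m , r′∉B)
    with first-failure (B? ∘ at) (subst B (sym (at-≤ z≤n)) q0∈B) (r′∉B ∘ subst B (at-≤ r′≤m))
  ... | s , 1+s≤r′ , s∈B , 1+s∉B
    with first-after (B? ∘ at) (s≤s (≤-trans 1+s≤r′ r′≤m)) (subst B (sym at-last) q0∈B)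
  ... | j , 1+s<j , j≤1+m , j∈B , inside =
    _ , _ , excursion r r≤m r∉A s (≤-trans 1+s≤r′ r′≤m) s∈B 1+s∉B j 1+s<j j≤1+m j∈B inside

first-step : ∀ {G : Graph} {u v k j} (w : Walk G u v k) → k ≡ suc j →
             E G u (vertex w 1) × Walk G (vertex w 1) v j
first-step (cons e w) refl = e , w

vertex-1-empty : ∀ {G : Graph} {u v k} (w : Walk G u v k) → k ≡ 0 → vertex w 1 ≡ u
vertex-1-empty nil refl = refl

module RootedTree (T : Graph) (connected : Connected T) (acyclic : ¬ HasCycle T) (τ : V T) where
  open Distance T connected public

  level : V T → ℕ
  level z = dist z τ

  parent : V T → V T
  parent z = vertex (dist-walk z τ) 1

  level-root : level τ ≡ 0
  level-root = dist-refl τ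

  parent-root : parent τ ≡ τ
  parent-root = vertex-1-empty (dist-walk τ τ) level-root

  parent-edge×level : ∀ {z} → z ≢ τ → E T z (parent z) × suc (level (parent z)) ≡ level z
  parent-edge×level {z} z≢τ with level-suc
    where
    level-suc : ∃[ j ] level z ≡ suc j
    level-suc with level z in level-z
    ... | zero = ⊥-elim (z≢τ (dist≡0⇒≡ level-z))
    ... | suc j = j , refl
  ... | j , level-z with first-step (dist-walk z τ) level-z
  ...   | e , rest = e , trans (cong suc (≤-antisym (dist-minimal rest) j≤)) (sym level-z)
    where
    j≤ : j ≤ level (parent z)
    j≤ = ≤-pred (subst (_≤ suc (level (parent z))) level-z
                  (dist-minimal (cons e (dist-walk (parent z) τ))))

  parent-edge : ∀ {z} → z ≢ τ → E T z (parent z)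
  parent-edge z≢τ = proj₁ (parent-edge×level z≢τ)

  level-parent : ∀ {z} → z ≢ τ → suc (level (parent z)) ≡ level z
  level-parent z≢τ = proj₂ (parent-edge×level z≢τ)

  level-parent-< : ∀ {z} → z ≢ τ → level (parent z) < level z
  level-parent-< z≢τ = ≤-reflexive (level-parent z≢τ)

  level-parent-≤ : ∀ z → level (parent z) ≤ level z
  level-parent-≤ z with z Fin.≟ τ
  ... | yes refl rewrite parent-root = ≤-refl
  ... | no z≢τ = <⇒≤ (level-parent-< z≢τ)

  parent-≢ : ∀ {z} → z ≢ τ → parent z ≢ z
  parent-≢ z≢τ same = <-irrefl (cong level same) (level-parent-< z≢τ)

  DownwardEnds : (ℕ → V T) → ℕ → Set
  DownwardEnds q m = IsPath T q m × 1 ≤ m × q 1 ≢ parent (q 0) × q (m ∸ 1) ≢ parent (q m)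

  downward-ends-reverse : ∀ {q m} → DownwardEnds q m → DownwardEnds (λ i → q (m ∸ i)) m
  downward-ends-reverse {q} {m} (path , 1≤m , first , last) = path-reverse path , 1≤m , last , first′
    where
    first′ : q (m ∸ (m ∸ 1)) ≢ parent (q (m ∸ m))
    first′ rewrite m∸[m∸n]≡n 1≤m | n∸n≡0 m = first

  descending-path-start≢root : ∀ {q m} → IsPath T q (suc m) → level (q (suc m)) ≤ level (q 0) →
                               q 0 ≢ τ
  descending-path-start≢root {q} {m} path end≤start q0≡τ
    with IsPath.distinct path 0 (suc m) z≤n ≤-refl (trans q0≡τ (sym (dist≡0⇒≡ (n≤0⇒n≡0 end≤root))))
    where
    end≤root : level (q (suc m)) ≤ 0
    end≤root = subst (level (q (suc m)) ≤_) (trans (cong level q0≡τ) level-root) end≤start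
  ... | ()

  -- Prepending the parent of the higher end lowers the level sum; the parent is new to
  -- the path, since otherwise it closes a cycle.
  climb : ∀ N → (∀ q m → level (q 0) + level (q m) < N → ¬ DownwardEnds q m) →
          ∀ q m → level (q m) ≤ level (q 0) → level (q 0) + level (q m) < suc N → ¬ DownwardEnds q m
  climb N shorter q (suc m) end≤start bound (path , 1≤m , first , last)
    with start≢τ ← descending-path-start≢root path end≤start
    with anyUpTo? (λ i → q i Fin.≟ parent (q 0)) (suc (suc m))
  ... | yes (zero , _ , same) = parent-≢ start≢τ (sym same)
  ... | yes (suc zero , _ , same) = first same
  ... | yes (suc (suc k) , s≤s i≤ , same) = acyclic (closed-path⇒cycle (path-prefix i≤ path)
                                                (subst (λ x → E T x (q 0)) (sym same) up))
    where up = E-sym T (parent-edge start≢τ)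
  ... | no fresh = shorter (parent (q 0) ◃ q) (suc (suc m)) bound′
                     (path-prepend up (λ i i≤ same → fresh (i , s≤s i≤ , same)) path ,
                      s≤s z≤n , first′ , last)
    where
    up = E-sym T (parent-edge start≢τ)
    first′ : q 0 ≢ parent (parent (q 0))
    first′ same = <-irrefl (sym (cong level same))
                    (≤-<-trans (level-parent-≤ (parent (q 0))) (level-parent-< start≢τ))
    bound′ : level (parent (q 0)) + level (q (suc m)) < N
    bound′ = ≤-pred (≤-trans (s≤s (+-monoˡ-< (level (q (suc m))) (level-parent-< start≢τ))) bound)

  no-downward-ends : ∀ N q m → level (q 0) + level (q m) < N → ¬ DownwardEnds q m
  no-downward-ends (suc N) q m bound ends with level (q m) ≤? level (q 0)
  ... | yes end≤start = climb N (no-downward-ends N) q m end≤start bound ends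
  ... | no end≰start =
    climb N (no-downward-ends N) (λ i → q (m ∸ i)) m end≤start′ bound′ (downward-ends-reverse ends)
    where
    start≡end : level (q (m ∸ m)) ≡ level (q 0)
    start≡end = cong (λ i → level (q i)) (n∸n≡0 m)
    end≤start′ : level (q (m ∸ m)) ≤ level (q m)
    end≤start′ = subst (_≤ level (q m)) (sym start≡end) (<⇒≤ (≰⇒> end≰start))
    bound′ : level (q m) + level (q (m ∸ m)) < suc N
    bound′ = subst (_< suc N) (trans (+-comm (level (q 0)) _) (cong (level (q m) +_) (sym start≡end)))
                   bound

  edge-to-parent : ∀ {z w} → E T z w → w ≡ parent z ⊎ z ≡ parent w
  edge-to-parent {z} {w} e with w Fin.≟ parent z | z Fin.≟ parent w
  ... | yes w≡ | _ = inj₁ w≡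
  ... | no _ | yes z≡ = inj₂ z≡
  ... | no w≢ | no z≢ =
    ⊥-elim (no-downward-ends _ (z ◃ λ _ → w) 1 ≤-refl (edge-path e , ≤-refl , w≢ , z≢))

  parent-unique : ∀ {z w} → E T z w → suc (level w) ≡ level z → w ≡ parent z
  parent-unique {z} {w} e level-w with edge-to-parent e
  ... | inj₁ w≡ = w≡
  ... | inj₂ z≡ = ⊥-elim (1+n≰n (subst (_≤ level w) (trans (sym (cong level z≡)) (sym level-w))
                                  (level-parent-≤ w)))

  path-to-root : ∀ {q} m → IsPath T q (suc m) → q (suc m) ≡ τ → q 1 ≡ parent (q 0)
  path-to-root {q} m path end≡τ with edge-to-parent (IsPath.step path 0 (s≤s z≤n))
  ... | inj₁ q1≡ = q1≡
  ... | inj₂ q0≡ = ⊥-elim (backtrack m path end≡τ)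
    where
    backtrack : ∀ m → IsPath T q (suc m) → q (suc m) ≡ τ → ⊥
    backtrack zero path end≡τ with IsPath.distinct path 0 1 z≤n ≤-refl
                                     (trans q0≡ (trans (cong parent end≡τ) (trans parent-root (sym end≡τ))))
    ... | ()
    backtrack (suc m) path end≡τ with IsPath.distinct path 0 2 z≤n (s≤s (s≤s z≤n))
                                        (trans q0≡ (sym (path-to-root m (path-tail path) end≡τ)))
    ... | ()

  iterate-parent-root : ∀ j → iterate parent τ j ≡ τ
  iterate-parent-root zero = refl
  iterate-parent-root (suc j) rewrite parent-root = iterate-parent-root j

  module Subtree (σ : V T) (σ≢τ : σ ≢ τ) where

    Descendant : V T → Set
    Descendant z = ∃[ j ] iterate parent z j ≡ σ

    descendant-level : ∀ j z → iterate parent z j ≡ σ → j + level σ ≡ level z × Walk T z σ j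
    descendant-level zero z refl = refl , nil
    descendant-level (suc j) z above with z Fin.≟ τ
    ... | yes refl = ⊥-elim (σ≢τ (trans (sym above)
                       (subst (λ x → iterate parent x j ≡ τ) (sym parent-root) (iterate-parent-root j))))
    ... | no z≢τ with descendant-level j (parent z) above
    ...   | levels , w = trans (cong suc levels) (level-parent z≢τ) , cons (parent-edge z≢τ) w

    non-descendant-walk : ∀ {z k} → ¬ Descendant z → Walk T z σ k →
                          ∃[ j ] j < k × Walk T z (parent σ) j
    non-descendant-walk outside nil = ⊥-elim (outside (0 , refl))
    non-descendant-walk {z} outside (cons {w = z′} e w) with edge-to-parent e
    ... | inj₁ refl = let j , j< , w′ = non-descendant-walk (λ (j , above) → outside (suc j , above)) w
                      in suc j , s≤s j< , cons e w′
    ... | inj₂ z≡ with z′ Fin.≟ σ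
    ...   | yes refl = 0 , s≤s z≤n , ≡⇒walk-0 T z≡
    ...   | no z′≢σ = let j , j< , w′ = non-descendant-walk outside′ w in suc j , s≤s j< , cons e w′
      where
      outside′ : ¬ Descendant z′
      outside′ (zero , z′≡σ) = z′≢σ z′≡σ
      outside′ (suc j , above) = outside (j , subst (λ x → iterate parent x j ≡ σ) (sym z≡) above)

    nearer-than-parent⇒deeper : ∀ v → dist v σ ≤ dist v (parent σ) → level σ + dist σ v ≤ level v
    nearer-than-parent⇒deeper v nearer with level σ + dist σ v ≤? level v
    ... | yes deeper = deeper
    ... | no shallower with non-descendant-walk outside (dist-walk v σ)
      where
      outside : ¬ Descendant v
      outside (j , above) with descendant-level j v above
      ... | levels , w = shallower (subst (level σ + dist σ v ≤_) (trans (+-comm (level σ) j) levels)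
                                    (+-monoʳ-≤ (level σ) (dist-minimal (reverse w))))
    ... | j , j< , w = ⊥-elim (<-irrefl refl (<-≤-trans (≤-<-trans (dist-minimal w) j<) nearer))

does-true : ∀ {A : Set} (a? : Dec A) → does a? ≡ true → A
does-true (yes a) _ = a

module FromRelation {m : ℕ} (R : Fin m → Fin m → Set) (R? : ∀ u v → Dec (R u v))
                    (R-sym : ∀ {u v} → R u v → R v u) (R-irrefl : ∀ {u} → ¬ R u u) where

  graph : Graph
  graph = record
    { n = m
    ; adj = λ u v → does (R? u v)
    ; sym = λ u v → does-⇔ (mk⇔ R-sym R-sym) (R? u v) (R? v u)
    ; irrefl = λ u → dec-false (R? u u) R-irrefl
    }

  edge⇒R : ∀ {u v} → E graph u v → R u v
  edge⇒R {u} {v} = does-true (R? u v)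

  R⇒edge : ∀ {u v} → R u v → E graph u v
  R⇒edge {u} {v} = dec-true (R? u v)

module Induced (U : Graph) {m : ℕ} (g : Fin m → V U) where
  open FromRelation (λ i j → E U (g i) (g j)) (λ i j → E? U (g i) (g j)) (E-sym U) (E-irrefl U) public

  g-hom : IsHomomorphism graph U g
  g-hom _ _ = edge⇒R

  restrict-isometric : ∀ {T} {f : V T → V U} → IsometricEmbedding T U f → (∀ a → ∃[ i ] g i ≡ f a) →
                       IsometricSubgraphOf T graph
  restrict-isometric {T} {f} iso covered = h , isometric-factor g h iso g-hom h-hom (proj₂ ∘ covered)
    where
    h : V T → Fin m
    h = proj₁ ∘ covered
    h-hom : IsHomomorphism T graph h
    h-hom a b e =
      R⇒edge (subst₂ (E U) (sym (proj₂ (covered a))) (sym (proj₂ (covered b))) (proj₁ (proj₂ iso) a b e))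

module DeleteEdge (U : Graph) (p q : V U) where

  IsPQ : V U → V U → Set
  IsPQ u v = (u ≡ p × v ≡ q) ⊎ (u ≡ q × v ≡ p)

  private
    IsPQ? : ∀ u v → Dec (IsPQ u v)
    IsPQ? u v = (u Fin.≟ p ×-dec v Fin.≟ q) ⊎-dec (u Fin.≟ q ×-dec v Fin.≟ p)

    IsPQ-sym : ∀ {u v} → IsPQ u v → IsPQ v u
    IsPQ-sym (inj₁ (u≡p , v≡q)) = inj₂ (v≡q , u≡p)
    IsPQ-sym (inj₂ (u≡q , v≡p)) = inj₁ (v≡p , u≡q)

  open FromRelation (λ u v → E U u v × ¬ IsPQ u v) (λ u v → E? U u v ×-dec ¬? (IsPQ? u v))
                    (λ (e , not-pq) → E-sym U e , not-pq ∘ IsPQ-sym) (λ (e , _) → E-irrefl U e) public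

  id-hom : IsHomomorphism graph U id
  id-hom _ _ e = proj₁ (edge⇒R e)

  restrict-isometric : ∀ {T} {f : V T → V U} → IsometricEmbedding T U f → ¬ (Image f p × Image f q) →
                       IsometricEmbedding T graph f
  restrict-isometric {T} {f} iso outside = isometric-factor id f iso id-hom hom (λ _ → refl)
    where
    hom : IsHomomorphism T graph f
    hom a b e = R⇒edge (proj₁ (proj₂ iso) a b e , λ
      { (inj₁ (fa≡p , fb≡q)) → outside ((a , fa≡p) , (b , fb≡q))
      ; (inj₂ (fa≡q , fb≡p)) → outside ((b , fb≡p) , (a , fa≡q)) })

module Quotient (U : Graph) {m : ℕ} (π : V U → Fin m) where

  Joined : Fin m → Fin m → Set
  Joined p q = p ≢ q × ∃[ u ] ∃[ v ] π u ≡ p × π v ≡ q × E U u v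

  private
    Joined? : ∀ p q → Dec (Joined p q)
    Joined? p q = ¬? (p Fin.≟ q) ×-dec
      Fin.any? (λ u → Fin.any? (λ v → π u Fin.≟ p ×-dec π v Fin.≟ q ×-dec E? U u v))

    Joined-sym : ∀ {p q} → Joined p q → Joined q p
    Joined-sym (p≢q , u , v , πu , πv , e) = p≢q ∘ sym , v , u , πv , πu , E-sym U e

  open FromRelation Joined Joined? Joined-sym (λ (p≢p , _) → p≢p refl) public

NoFurther : (U : Graph) {T : Graph} → (V T → V U) → V U → V U → Set
NoFurther U f x y = ∀ a k → Walk U (f a) y k → Walk≤ U (f a) x k

GluesOnly : ∀ {N m} → Fin N → Fin N → (Fin N → Fin m) → Set
GluesOnly x y π = ∀ u v → π u ≡ π v → u ≡ v ⊎ (u ≡ x × v ≡ y) ⊎ (u ≡ y × v ≡ x)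

module Merge (U : Graph) {m : ℕ} (π : V U → Fin m) (x y : V U) (π-glues : GluesOnly x y π) where
  open Quotient U π public

  Merged : V U → Set
  Merged e = e ≡ x ⊎ e ≡ y

  -- only the first entry into and the last exit from the merged pair matter
  LiftedWalk : V U → V U → ℕ → Set
  LiftedWalk u w k = Walk≤ U u w k ⊎
    (∃[ e ] ∃[ e′ ] Merged e × Merged e′ × ∃[ j ] ∃[ j′ ] j + j′ ≤ k × Walk U u e j × Walk U e′ w j′)

  private
    prepend : ∀ {u u′ w k} → E U u u′ → LiftedWalk u′ w k → LiftedWalk u w (suc k)
    prepend e (inj₁ (j , j≤k , w)) = inj₁ (suc j , s≤s j≤k , cons e w)
    prepend e (inj₂ (_ , _ , me , me′ , j , j′ , j+j′≤k , w , w′)) =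
      inj₂ (_ , _ , me , me′ , suc j , j′ , s≤s j+j′≤k , cons e w , w′)

    jump : ∀ {u u′ u″ w k} → Merged u → Merged u′ → E U u′ u″ → LiftedWalk u″ w k →
           LiftedWalk u w (suc k)
    jump mu mu′ e (inj₁ (j , j≤k , w)) = inj₂ (_ , _ , mu , mu′ , 0 , suc j , s≤s j≤k , nil , cons e w)
    jump mu mu′ e (inj₂ (_ , _ , _ , me′ , j , j′ , j+j′≤k , _ , w′)) =
      inj₂ (_ , _ , mu , me′ , 0 , j′ , ≤-trans (m≤n+m j′ j) (m≤n⇒m≤1+n j+j′≤k) , nil , w′)

  lift : ∀ {p q k} → Walk graph p q k → ∀ u → π u ≡ p → ∃[ w ] π w ≡ q × LiftedWalk u w k
  lift nil u πu≡p = u , πu≡p , inj₁ (0 , z≤n , nil)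
  lift (cons e p) u πu≡p with edge⇒R e
  ... | _ , u′ , u″ , πu′ , πu″ , eU with lift p u″ πu″
  ...   | w , πw , lifted with π-glues u u′ (trans πu≡p (sym πu′))
  ...     | inj₁ refl = w , πw , prepend eU lifted
  ...     | inj₂ (inj₁ (refl , refl)) = w , πw , jump (inj₁ refl) (inj₂ refl) eU lifted
  ...     | inj₂ (inj₂ (refl , refl)) = w , πw , jump (inj₂ refl) (inj₁ refl) eU lifted

  module _ {T : Graph} {f : V T → V U} (iso : IsometricEmbedding T U f)
           (avoids-y : ∀ a → f a ≢ y) (x-no-further : NoFurther U {T} f x y) where

    private
      to-x : ∀ a {e j} → Merged e → Walk U (f a) e j → Walk≤ U (f a) x j
      to-x a (inj₁ refl) w = _ , ≤-refl , w
      to-x a (inj₂ refl) w = x-no-further a _ w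

      from-x : ∀ b {e j} → Merged e → Walk U e (f b) j → Walk≤ U x (f b) j
      from-x b me w = let i , i≤j , v = to-x b me (reverse w) in i , i≤j , reverse v

      resolve : ∀ a b {k} → LiftedWalk (f a) (f b) k → Walk≤ U (f a) (f b) k
      resolve a b (inj₁ w) = w
      resolve a b (inj₂ (_ , _ , me , me′ , j , j′ , j+j′≤k , w , w′)) =
        let i , i≤j , v = to-x a me w ; i′ , i′≤j′ , v′ = from-x b me′ w′
        in i + i′ , ≤-trans (+-mono-≤ i≤j i′≤j′) j+j′≤k , v ++ v′

      resolve-y : ∀ a {k} → LiftedWalk (f a) y k → Walk≤ U (f a) x k
      resolve-y a (inj₁ (j , j≤k , w)) =
        let i , i≤j , v = to-x a (inj₂ refl) w in i , ≤-trans i≤j j≤k , v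
      resolve-y a (inj₂ (_ , _ , me , _ , j , j′ , j+j′≤k , w , _)) =
        let i , i≤j , v = to-x a me w in i , ≤-trans i≤j (≤-trans (m≤m+n j j′) j+j′≤k) , v

      injective : Injective _≡_ _≡_ (π ∘ f)
      injective {a} {b} same with π-glues (f a) (f b) same
      ... | inj₁ fa≡fb = proj₁ iso fa≡fb
      ... | inj₂ (inj₁ (_ , fb≡y)) = ⊥-elim (avoids-y b fb≡y)
      ... | inj₂ (inj₂ (fa≡y , _)) = ⊥-elim (avoids-y a fa≡y)

      hom : IsHomomorphism T graph (π ∘ f)
      hom a b e = R⇒edge (E⇒≢ T e ∘ injective , f a , f b , refl , refl , proj₁ (proj₂ iso) a b e)

      pulls-back-to-U : ∀ a b k → Walk graph (π (f a)) (π (f b)) k → Walk≤ U (f a) (f b) k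
      pulls-back-to-U a b k w with lift w (f a) refl
      ... | w′ , πw′ , lifted with π-glues w′ (f b) πw′
      ...   | inj₁ refl = resolve a b lifted
      ...   | inj₂ (inj₁ (_ , fb≡y)) = ⊥-elim (avoids-y b fb≡y)
      ...   | inj₂ (inj₂ (refl , fb≡x)) =
        let j , j≤k , v = resolve-y a lifted in j , j≤k , subst (λ z → Walk U (f a) z j) (sym fb≡x) v

    merge-isometric : IsometricEmbedding T graph (π ∘ f)
    merge-isometric = pulls-back-walks⇒isometric injective hom λ a b k w →
      let j , j≤k , wU = pulls-back-to-U a b k w ; i , i≤j , wT = isometric⇒pulls-back-walks iso a b j wU
      in i , ≤-trans i≤j j≤k , wT

merge-map : ∀ {N} (x y : Fin N) → x ≢ y → ∃[ m ] suc m ≡ N × Σ (Fin N → Fin m) (GluesOnly x y)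
merge-map {suc m} x y x≢y = m , refl , π , λ u v → glues u v (u Fin.≟ y) (v Fin.≟ y)
  where
  π′ : ∀ u → Dec (u ≡ y) → Fin m
  π′ u (yes _) = punchOut (x≢y ∘ sym)
  π′ u (no u≢y) = punchOut (u≢y ∘ sym)
  π : Fin (suc m) → Fin m
  π u = π′ u (u Fin.≟ y)
  glues : ∀ u v (u? : Dec (u ≡ y)) (v? : Dec (v ≡ y)) → π′ u u? ≡ π′ v v? →
          u ≡ v ⊎ (u ≡ x × v ≡ y) ⊎ (u ≡ y × v ≡ x)
  glues u v (yes refl) (yes refl) _ = inj₁ refl
  glues u v (yes refl) (no _) same = inj₂ (inj₂ (refl , sym (Fin.punchOut-injective {i = y} _ _ same)))
  glues u v (no _) (yes refl) same = inj₂ (inj₁ (Fin.punchOut-injective {i = y} _ _ same , refl))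
  glues u v (no _) (no _) same = inj₁ (Fin.punchOut-injective {i = y} _ _ same)

delete-one : ∀ {N} (w : Fin N) → ∃[ m ] suc m ≡ N × Σ (Fin m → Fin N) λ g →
             Injective _≡_ _≡_ g × (∀ i → g i ≢ w) × (∀ v → v ≢ w → ∃[ i ] g i ≡ v)
delete-one {suc m} w = m , refl , punchIn w , Fin.punchIn-injective w _ _ , Fin.punchInᵢ≢i w ,
                       λ v v≢w → punchOut (v≢w ∘ sym) , Fin.punchIn-punchOut _

module Redirect {U Tα Tβ : Graph} (α-tree : IsTree Tα) (β-tree : IsTree Tβ)
  {fα : V Tα → V U} (isoα : IsometricEmbedding Tα U fα)
  {fβ : V Tβ → V U} (isoβ : IsometricEmbedding Tβ U fβ)
  (edge-cover : CoversEdges U (Image fα) (Image fβ))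
  {σα τα : V Tα} {σβ τβ : V Tβ} (σ-shared : fα σα ≡ fβ σβ) (τ-shared : fα τα ≡ fβ τβ)
  (σα≢τα : σα ≢ τα)
  where

  module α = RootedTree Tα (proj₁ (proj₂ α-tree)) (proj₂ (proj₂ α-tree)) τα
  module β = RootedTree Tβ (proj₁ (proj₂ β-tree)) (proj₂ (proj₂ β-tree)) τβ

  σβ≢τβ : σβ ≢ τβ
  σβ≢τβ σβ≡τβ = σα≢τα (proj₁ isoα (trans σ-shared (trans (cong fβ σβ≡τβ) (sym τ-shared))))

  private
    ξα = α.parent σα
    ξβ = β.parent σβ

    shared : ∀ {a b a′ b′} → fα a ≡ fβ a′ → fα b ≡ fβ b′ → α.dist a b ≡ β.dist a′ b′
    shared = shared-dist (proj₁ (proj₂ α-tree)) (proj₁ (proj₂ β-tree)) isoα isoβ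

    -- a shared vertex at least as close to σ as to its α-parent lies below σ in both trees,
    -- so it is strictly closer to σ than to the β-parent
    below-σ : ∀ {a ρ} → fα a ≡ fβ ρ → α.dist a σα ≤ α.dist a ξα → ¬ β.dist ρ ξβ ≤ β.dist ρ σβ
    below-σ {a} {ρ} a-shared nearer ξβ-nearer = 1+n≰n (begin
      suc (β.dist ρ σβ + β.level ξβ) ≡⟨ sym (+-suc (β.dist ρ σβ) _) ⟩
      β.dist ρ σβ + suc (β.level ξβ) ≡⟨ cong₂ _+_ (β.dist-sym ρ σβ) (β.level-parent σβ≢τβ) ⟩
      β.dist σβ ρ + β.level σβ       ≡⟨ +-comm (β.dist σβ ρ) _ ⟩
      β.level σβ + β.dist σβ ρ       ≡⟨ cong₂ _+_ (shared σ-shared τ-shared) (shared σ-shared a-shared) ⟨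
      α.level σα + α.dist σα a       ≤⟨ α.Subtree.nearer-than-parent⇒deeper σα σα≢τα a nearer ⟩
      α.level a                      ≡⟨ shared a-shared τ-shared ⟩
      β.level ρ                      ≤⟨ β.dist-triangle ρ ξβ τβ ⟩
      β.dist ρ ξβ + β.level ξβ       ≤⟨ +-monoˡ-≤ (β.level ξβ) ξβ-nearer ⟩
      β.dist ρ σβ + β.level ξβ       ∎)
      where open ≤-Reasoning

  parent-no-further : ∀ {a ρ} → fα a ≡ fβ ρ → α.dist a ξα ≤ β.dist ρ ξβ
  parent-no-further {a} {ρ} a-shared with suc (β.dist ρ σβ) ≤? β.dist ρ ξβ
  ... | yes σβ-nearer = begin
    α.dist a ξα                 ≤⟨ α.dist-triangle a σα ξα ⟩
    α.dist a σα + α.dist σα ξα  ≤⟨ +-monoʳ-≤ _ (α.dist-edge (α.parent-edge σα≢τα)) ⟩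
    α.dist a σα + 1             ≡⟨ trans (+-comm _ 1) (cong suc (shared a-shared σ-shared)) ⟩
    suc (β.dist ρ σβ)           ≤⟨ σβ-nearer ⟩
    β.dist ρ ξβ                 ∎
    where open ≤-Reasoning
  ... | no σβ-not-nearer = ≤-pred (begin
    suc (α.dist a ξα)           ≤⟨ ≰⇒> (λ nearer → below-σ a-shared nearer ξβ-nearer) ⟩
    α.dist a σα                 ≡⟨ shared a-shared σ-shared ⟩
    β.dist ρ σβ                 ≤⟨ β.dist-triangle ρ ξβ σβ ⟩
    β.dist ρ ξβ + β.dist ξβ σβ  ≤⟨ +-monoʳ-≤ _ (β.dist-edge (E-sym Tβ (β.parent-edge σβ≢τβ))) ⟩
    β.dist ρ ξβ + 1             ≡⟨ +-comm _ 1 ⟩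
    suc (β.dist ρ ξβ)           ∎)
    where
    open ≤-Reasoning
    ξβ-nearer : β.dist ρ ξβ ≤ β.dist ρ σβ
    ξβ-nearer = ≤-pred (≰⇒> σβ-not-nearer)

  from-shared : ∀ {a ρ k} → fα a ≡ fβ ρ → Walk U (fα a) (fβ ξβ) k → Walk≤ U (fα a) (fα ξα) k
  from-shared {a} {ρ} {k} a-shared w
    with j , j≤k , wβ ← isometric⇒pulls-back-walks isoβ ρ ξβ _ (subst (λ z → Walk U z (fβ ξβ) k) a-shared w)
    = α.dist a ξα , ≤-trans (parent-no-further a-shared) (≤-trans (β.dist-minimal wβ) j≤k) ,
      map-walk (proj₁ (proj₂ isoα)) (α.dist-walk a ξα)

  -- follow the walk while it stays in the image of fα; where it leaves, its vertex is shared
  redirect : (∀ a → fα a ≢ fβ ξβ) → NoFurther U {Tα} fα (fα ξα) (fβ ξβ)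
  redirect ξβ-outside a k w = along w a refl
    where
    along : ∀ {u k} → Walk U u (fβ ξβ) k → ∀ a → fα a ≡ u → Walk≤ U (fα a) (fα ξα) k
    along nil a fa≡y = ⊥-elim (ξβ-outside a fa≡y)
    along {u} (cons {w = w} e rest) a refl with Image? fα w
    ... | yes (a′ , refl) = let j , j≤k , v = along rest a′ refl in suc j , s≤s j≤k , cons e v
    ... | no w∉α with edge-cover u w e
    ...   | inj₁ (_ , w∈α) = ⊥-elim (w∉α w∈α)
    ...   | inj₂ ((ρ , fρ≡u) , _) = from-shared (sym fρ≡u) (cons e rest)

covered-acyclic : ∀ {T₁ T₂ U : Graph} {f₁ : V T₁ → V U} {f₂ : V T₂ → V U} →
  IsometricEmbedding T₁ U f₁ → IsometricEmbedding T₂ U f₂ → ¬ HasCycle T₁ → ¬ HasCycle T₂ →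
  CoversVertices (Image f₁) (Image f₂) → CoversEdges U (Image f₁) (Image f₂) →
  (∀ {p ℓ} → ¬ Excursion U (Image f₁) (Image f₂) p ℓ) →
  (∀ {p ℓ} → ¬ Excursion U (Image f₂) (Image f₁) p ℓ) →
  ¬ HasCycle U
covered-acyclic {U = U} {f₁ = f₁} {f₂} iso₁ iso₂ T₁-acyclic T₂-acyclic vertex-cover edge-cover
                no-excursion₁₂ no-excursion₂₁ cycle
  with k , q , path , closing ← cycle⇒closed-path cycle
  with anyUpTo? (¬? ∘ Image? f₁ ∘ q) (3 + k) | anyUpTo? (¬? ∘ Image? f₂ ∘ q) (3 + k)
... | no none∉₁ | _ = T₁-acyclic (lift-cycle iso₁ path closing (none-fails (Image? f₁ ∘ q) none∉₁))
... | yes _ | no none∉₂ = T₂-acyclic (lift-cycle iso₂ path closing (none-fails (Image? f₂ ∘ q) none∉₂))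
... | yes (r₁ , s≤s r₁≤ , r₁∉) | yes (r₂ , s≤s r₂≤ , r₂∉) with vertex-cover (q 0)
...   | inj₂ q0∈₂ = no-excursion₁₂ (proj₂ (proj₂ (CycleExcursion.cycle-excursion (Image? f₂)
                      vertex-cover edge-cover path closing q0∈₂
                      (r₁ , r₁≤ , r₁∉) (r₂ , r₂≤ , r₂∉))))
...   | inj₁ q0∈₁ = no-excursion₂₁ (proj₂ (proj₂ (CycleExcursion.cycle-excursion (Image? f₁)
                      (CoversVertices-swap vertex-cover) (CoversEdges-swap {U} edge-cover)
                      path closing q0∈₁ (r₂ , r₂≤ , r₂∉) (r₁ , r₁≤ , r₁∉))))

module MinimalUniversal {T₁ T₂ U : Graph}
  (minimal : ∀ H g → SubgraphEmbedding H U g → ¬ IsWhole H U g → ¬ IsoUniversal2 T₁ T₂ H)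
  {f₁ : V T₁ → V U} (iso₁ : IsometricEmbedding T₁ U f₁)
  {f₂ : V T₂ → V U} (iso₂ : IsometricEmbedding T₂ U f₂)
  where

  vertex-cover : CoversVertices (Image f₁) (Image f₂)
  vertex-cover v with Image? f₁ v | Image? f₂ v
  ... | yes in₁ | _ = inj₁ in₁
  ... | no _ | yes in₂ = inj₂ in₂
  ... | no ∉₁ | no ∉₂ with delete-one v
  ...   | _ , _ , g , g-injective , g-avoids , g-onto =
    ⊥-elim (minimal graph g (g-injective , g-hom) proper
              (restrict-isometric iso₁ (λ a → g-onto (f₁ a) (λ fa≡v → ∉₁ (a , fa≡v))) ,
               restrict-isometric iso₂ (λ b → g-onto (f₂ b) (λ fb≡v → ∉₂ (b , fb≡v)))))
    where
    open Induced U g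
    proper : ¬ IsWhole graph U g
    proper (onto , _) = g-avoids _ (proj₂ (onto v) refl)

  edge-cover : CoversEdges U (Image f₁) (Image f₂)
  edge-cover u v e with Image? f₁ u ×-dec Image? f₁ v | Image? f₂ u ×-dec Image? f₂ v
  ... | yes in₁ | _ = inj₁ in₁
  ... | no _ | yes in₂ = inj₂ in₂
  ... | no ∉₁ | no ∉₂ =
    ⊥-elim (minimal graph id ((λ same → same) , id-hom) proper
              ((f₁ , restrict-isometric iso₁ ∉₁) , (f₂ , restrict-isometric iso₂ ∉₂)))
    where
    open DeleteEdge U u v
    proper : ¬ IsWhole graph U id
    proper (_ , reflects) = proj₂ (edge⇒R (reflects u v e)) (inj₁ (refl , refl))

module MinimumUniversal {T₁ T₂ U : Graph}
  (minimum : ∀ U′ → IsoUniversal2 T₁ T₂ U′ → n U ≤ n U′)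
  {f₁ : V T₁ → V U} (iso₁ : IsometricEmbedding T₁ U f₁)
  {f₂ : V T₂ → V U} (iso₂ : IsometricEmbedding T₂ U f₂)
  where

  -- merging x and y would give a smaller isometric-universal graph
  no-merge : ∀ {x y} → x ≢ y → (∀ a → f₁ a ≢ y) → NoFurther U {T₁} f₁ x y →
                              (∀ b → f₂ b ≢ x) → NoFurther U {T₂} f₂ y x → ⊥
  no-merge {x} {y} x≢y avoids-y x-no-further avoids-x y-no-further with merge-map x y x≢y
  ... | m , 1+m≡n , π , glues = 1+n≰n (subst (_≤ m) (sym 1+m≡n) (minimum graph universal))
    where
    open Merge U π x y glues using (graph; merge-isometric)
    module Swapped = Merge U π y x (λ u v same → Sum.map₂ Sum.swap (glues u v same))
    universal : IsoUniversal2 T₁ T₂ graph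
    universal = (π ∘ f₁ , merge-isometric iso₁ avoids-y x-no-further) ,
                (π ∘ f₂ , Swapped.merge-isometric iso₂ avoids-x y-no-further)

module OptimalUniversal {T₁ T₂ U : Graph}
  (minimum : ∀ U′ → IsoUniversal2 T₁ T₂ U′ → n U ≤ n U′)
  (minimal : ∀ H g → SubgraphEmbedding H U g → ¬ IsWhole H U g → ¬ IsoUniversal2 T₁ T₂ H)
  {f₁ : V T₁ → V U} (iso₁ : IsometricEmbedding T₁ U f₁)
  {f₂ : V T₂ → V U} (iso₂ : IsometricEmbedding T₂ U f₂)
  where

  open MinimalUniversal minimal iso₁ iso₂ public
  open MinimumUniversal minimum iso₁ iso₂ public

  private
    hom₁ = proj₁ (proj₂ iso₁)
    hom₂ = proj₁ (proj₂ iso₂)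

  -- two components would contain x₀ = f₁ a₀ and y₀ = f₂ b₀ separately, and could be glued there
  connected : Connected T₁ → Connected T₂ → V T₁ → V T₂ → Connected U
  connected T₁-connected T₂-connected a₀ b₀ with Reachable? U (f₁ a₀) (f₂ b₀)
  ... | yes x₀↝y₀ = λ u v → Reachable-trans (to-x₀ u) (Reachable-sym (to-x₀ v))
    where
    to-x₀ : ∀ u → Reachable U u (f₁ a₀)
    to-x₀ u with vertex-cover u
    ... | inj₁ (a , refl) = image-reachable hom₁ T₁-connected a a₀
    ... | inj₂ (b , refl) = Reachable-trans (image-reachable hom₂ T₂-connected b b₀) (Reachable-sym x₀↝y₀)
  ... | no x₀↛y₀ = ⊥-elim (no-merge (avoids-y₀ a₀) avoids-y₀ (λ a _ w → ⊥-elim (unreachable₁ a w))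
                                              avoids-x₀ (λ b _ w → ⊥-elim (unreachable₂ b w)))
    where
    unreachable₁ : ∀ a {k} → ¬ Walk U (f₁ a) (f₂ b₀) k
    unreachable₁ a w = x₀↛y₀ (Reachable-trans (image-reachable hom₁ T₁-connected a₀ a) (_ , w))
    unreachable₂ : ∀ b {k} → ¬ Walk U (f₂ b) (f₁ a₀) k
    unreachable₂ b w =
      x₀↛y₀ (Reachable-sym (Reachable-trans (image-reachable hom₂ T₂-connected b₀ b) (_ , w)))
    avoids-y₀ : ∀ a → f₁ a ≢ f₂ b₀
    avoids-y₀ a = unreachable₁ a ∘ ≡⇒walk-0 U
    avoids-x₀ : ∀ b → f₂ b ≢ f₁ a₀
    avoids-x₀ b = unreachable₂ b ∘ ≡⇒walk-0 U

  module _ (T₁-tree : IsTree T₁) (T₂-tree : IsTree T₂) where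

    private
      T₁-connected = proj₁ (proj₂ T₁-tree)
      T₂-connected = proj₁ (proj₂ T₂-tree)
      module Rooted₁ = RootedTree T₁ T₁-connected (proj₂ (proj₂ T₁-tree))

    -- otherwise the two parents could be merged, each tree keeping its distances by redirect
    shared-parent : ∀ {σ₁ τ₁ σ₂ τ₂} → f₁ σ₁ ≡ f₂ σ₂ → f₁ τ₁ ≡ f₂ τ₂ → σ₁ ≢ τ₁ →
                    Image f₂ (f₁ (Rooted₁.parent τ₁ σ₁))
    shared-parent {σ₁} {τ₁} {σ₂} {τ₂} σ-shared τ-shared σ₁≢τ₁
      with Image? f₂ (f₁ (Rooted₁.parent τ₁ σ₁))
    ... | yes ξ₁∈₂ = ξ₁∈₂
    ... | no ξ₁∉₂ = ⊥-elim (no-merge (ξ₂-outside _) ξ₂-outside (R₁.redirect ξ₂-outside)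
                                      ξ₁-outside (R₂.redirect ξ₁-outside))
      where
      module R₁ = Redirect T₁-tree T₂-tree iso₁ iso₂ edge-cover σ-shared τ-shared σ₁≢τ₁
      module R₂ = Redirect T₂-tree T₁-tree iso₂ iso₁ (CoversEdges-swap {U} edge-cover)
                    (sym σ-shared) (sym τ-shared) R₁.σβ≢τβ
      ξ₁-outside : ∀ b → f₂ b ≢ f₁ (R₁.α.parent σ₁)
      ξ₁-outside b same = ξ₁∉₂ (b , same)
      ξ₂-outside : ∀ a → f₁ a ≢ f₂ (R₁.β.parent σ₂)
      ξ₂-outside a fa≡ξ₂ = ξ₁-outside (R₁.β.parent σ₂) (trans (sym fa≡ξ₂) (cong f₁ a≡ξ₁))
        where
        a-level : suc (R₁.α.level a) ≡ R₁.α.level σ₁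
        a-level = trans (cong suc (shared-dist T₁-connected T₂-connected iso₁ iso₂ fa≡ξ₂ τ-shared))
                    (trans (R₁.β.level-parent R₁.σβ≢τβ)
                      (sym (shared-dist T₁-connected T₂-connected iso₁ iso₂ σ-shared τ-shared)))
        a≡ξ₁ : a ≡ R₁.α.parent σ₁
        a≡ξ₁ = R₁.α.parent-unique (isometric-reflects-edges iso₁ σ₁ a (subst₂ (E U) (sym σ-shared) (sym fa≡ξ₂)
                 (hom₂ _ _ (R₁.β.parent-edge R₁.σβ≢τβ)))) a-level

    -- lifted to T₁, the excursion is a path between shared vertices that starts towards the parent
    no-excursion : ∀ {p ℓ} → ¬ Excursion U (Image f₁) (Image f₂) p ℓ
    no-excursion {p} {ℓ} (path , in₁ , (σ₂ , σ-shared) , second∉₂ , (τ₂ , τ-shared))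
      with p₁ , lifts ← bounded-choice in₁ = second∉₂ (subst (Image f₂) second-in-U
        (shared-parent (trans (lifts 0 z≤n) (sym σ-shared)) (trans (lifts _ ≤-refl) (sym τ-shared))
                       σ₁≢τ₁))
      where
      path₁ : IsPath T₁ p₁ (suc ℓ)
      path₁ = lift-path iso₁ lifts path
      σ₁≢τ₁ : p₁ 0 ≢ p₁ (suc ℓ)
      σ₁≢τ₁ same with () ← IsPath.distinct path₁ 0 (suc ℓ) z≤n ≤-refl same
      second-in-U : f₁ (Rooted₁.parent (p₁ (suc ℓ)) (p₁ 0)) ≡ p 1
      second-in-U =
        trans (cong f₁ (sym (Rooted₁.path-to-root (p₁ (suc ℓ)) ℓ path₁ refl))) (lifts 1 (s≤s z≤n))

theorem2 : (T₁ T₂ U : Graph) → IsTree T₁ → IsTree T₂ →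
    MinimumIsoUniversal2 T₁ T₂ U → MinimalIsoUniversal2 T₁ T₂ U → IsTree U
theorem2 T₁ T₂ U T₁-tree@(T₁-nonempty , T₁-connected , T₁-acyclic)
                  T₂-tree@(T₂-nonempty , T₂-connected , T₂-acyclic)
                  (((f₁ , iso₁) , (f₂ , iso₂)) , minimum) (_ , minimal) =
  ≤-trans (s≤s z≤n) (Fin.toℕ<n (f₁ a₀)) ,
  connected T₁-connected T₂-connected a₀ b₀ ,
  covered-acyclic iso₁ iso₂ T₁-acyclic T₂-acyclic vertex-cover edge-cover
    (no-excursion T₁-tree T₂-tree) (Swapped.no-excursion T₂-tree T₁-tree)
  where
  open OptimalUniversal minimum minimal iso₁ iso₂
  module Swapped = OptimalUniversal (λ U′ (in₁ , in₂) → minimum U′ (in₂ , in₁))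
                                    (λ H g sub proper (in₁ , in₂) → minimal H g sub proper (in₂ , in₁))
                                    iso₂ iso₁
  a₀ : V T₁
  a₀ = fromℕ< T₁-nonempty
  b₀ : V T₂
  b₀ = fromℕ< T₂-nonempty
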